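{- Consider instances of Max Ext-Representation in which every candidate is a voter and approves of at least one candidate other than themselves. On such instances the greedy algorithm achieves approximation ratio $\frac{e-1}{e+1}$, i.e. its committee $A_p$ satisfies $ext(A_p) \geq \frac{e-1}{e+1}\max_{C\subseteq Z,|C|=p} ext(C)$.
   Context: Election setting: voters $X$, candidates $Z$; each voter approves of a subset of $Z$, and $S_j\subseteq X$ is the set of voters approving candidate $c_j$. For a committee $C\subseteq Z$, the number of externally represented voters is $ext(C) = \left|\bigcup_{c_j\in C} S_j \setminus C\right|$ (voters approving of some committee member, excluding the committee members). Max Ext-Representation: given $p$, find $C\subseteq Z$ with $|C|=p$ maximizing $ext(C)$. Let $\widetilde{rep}(C) = \left|\bigcup_{c_j\in C} S_j \cup C\right|$ (represented voters when every candidate is regarded as approving of themselves); note $ext(C) = \widetilde{rep}(C)-|C|$. The greedy algorithm starts from $A_0=\emptyset$ and sets $A_{i+1} = A_i\cup\{\arg\max_{c\in Z\setminus A_i}\widetilde{rep}(A_i\cup\{c\})\}$ for $i<p$, returning $A_p$. -}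

module Defs where

open import Data.Nat using (ℕ; zero; suc; _+_; _*_; _∸_; _≤_; _!)
open import Data.Bool using (Bool; true; false; _∧_; _∨_)
open import Data.Fin using (Fin; zero; suc; _≟_)
open import Data.Fin.Subset using (Subset; ⊥; ⁅_⁆; _∈_; _∉_; _∪_; _∩_; ∁; ∣_∣)
open import Data.Vec using (lookup; tabulate)
open import Relation.Nullary.Decidable using (⌊_⌋)
open import Relation.Binary.PropositionalEquality using (_≡_; _≢_)
open import Data.Product using (∃; _×_)
open import Function.Definitions using (Injective)

anyF : ∀ {n} → (Fin n → Bool) → Bool
anyF {zero}  f = false
anyF {suc n} f = f zero ∨ anyF (λ i → f (suc i))

-- Every candidate is a voter: `asVoter` embeds candidates into voters injectively.
-- `approves v c ≡ true` means voter v approves of candidate c (i.e. v ∈ S_c).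
record Election : Set where
  field
    nv nc    : ℕ
    approves : Fin nv → Fin nc → Bool
    asVoter  : Fin nc → Fin nv
    asVoter-injective : Injective _≡_ _≡_ asVoter

module _ (E : Election) where
  open Election E

  approverSet : Subset nc → Subset nv
  approverSet C = tabulate (λ v → anyF (λ c → lookup C c ∧ approves v c))

  memberSet : Subset nc → Subset nv
  memberSet C = tabulate (λ v → anyF (λ c → lookup C c ∧ ⌊ asVoter c ≟ v ⌋))

  ext : Subset nc → ℕ
  ext C = ∣ approverSet C ∩ ∁ (memberSet C) ∣

  repT : Subset nc → ℕ
  repT C = ∣ approverSet C ∪ memberSet C ∣

  ApprovesOther : Set
  ApprovesOther = ∀ (c : Fin nc) → ∃ λ c' → c' ≢ c × approves (asVoter c) c' ≡ true

  -- GreedyRun i A : A is a possible value of A_i of the greedy algorithm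
  -- (with arbitrary tie-breaking among maximisers of rep~).
  data GreedyRun : ℕ → Subset nc → Set where
    start : GreedyRun 0 ⊥
    step  : ∀ {i A} (c : Fin nc) → GreedyRun i A → c ∉ A →
            (∀ (c' : Fin nc) → c' ∉ A → repT (A ∪ ⁅ c' ⁆) ≤ repT (A ∪ ⁅ c ⁆)) →
            GreedyRun (suc i) (A ∪ ⁅ c ⁆)

-- Rational approximations of e from below:  s_n = Σ_{k=0}^{n} 1/k!  = eNum n / n!,
-- where eNum n = Σ_{k=0}^{n} n!/k!, computed by
--   eNum 0 = 1,   eNum (n+1) = (n+1) * eNum n + 1.
-- s_n is strictly increasing with supremum e.
eNum : ℕ → ℕ
eNum zero    = 1
eNum (suc n) = suc n * eNum n + 1

-- Write R = rep~(C), Fᵢ = rep~(Aᵢ) and p = |C|. Counting every candidate as a voter who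
-- approves of itself gives ext X = rep~ X − |X|, and rep~ is a coverage function, so the p
-- members of C cover at most Fᵢ + p·g voters, where g is the largest marginal gain, the one
-- greedy takes. Hence R − Fᵢ ≤ p (Fᵢ₊₁ − Fᵢ), and iterating, R − F_p ≤ (1 − 1/p)^p R ≤ R / e,
-- i.e. ext A + p ≥ (1 − 1/e)(ext C + p); this gives the ratio (e − 1)/(e + 1) once ext A ≥ p,
-- which holds when every greedy step gains at least two voters (then F_p ≥ 2p). Otherwise
-- some step i gains a single voter while Fᵢ ≥ 2i; then R ≤ Fᵢ + p already forces
-- ext C ≤ 2 ext A. Throughout, e is replaced
-- by its lower approximations eNum n / n!, via (eNum n / n!) (1 − 1/p)^p ≤ 1.

module Submission where

open import Defs
open import Data.Nat.Properties hiding (_≟_)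
open import Algebra.Properties.Semiring.Sum +-*-semiring
  using (sum; sum-syntax; sum-cong-≗; ∑-distrib-+; ∑-comm; sum-replicate-zero; *-distribˡ-sum; *-distribʳ-sum; sum-remove)
open import Data.Bool using (Bool; true; false; _∧_; _∨_)
open import Data.Bool.Properties using (∨-zeroʳ; ∧-distribˡ-∨)
open import Data.Fin using (Fin; zero; suc; _≟_)
open import Data.Fin.Properties as Fin using ()
open import Data.Fin.Subset using (Subset; ⊥; ⁅_⁆; _∈_; _∉_; _⊆_; _∪_; _∩_; ∁; ∣_∣; inside; outside)
open import Data.Fin.Subset.Properties
  using (_∈?_; x∈⁅x⁆; x∈⁅y⁆⇒x≡y; x≢y⇒x∉⁅y⁆; ∣⁅x⁆∣≡1; ∣⊥∣≡0; ∪-identityʳ; ⊆-antisym; p⊆p∪q; x∈p∪q⁻; x∈p∪q⁺;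
         p⊆q⇒∣p∣≤∣q∣; Empty-unique)
open import Data.Nat using (ℕ; zero; suc; _+_; _*_; _∸_; _^_; _≤_; _<_; _!; z≤n; s≤s; >-nonZero)
open import Data.Nat.Tactic.RingSolver using (solve-∀)
open import Data.Product using (∃; _×_; _,_)
open import Data.Sum using (inj₂; [_,_])
open import Data.Vec using ([]; _∷_; lookup; tabulate; here; there)
open import Data.Vec.Properties using ([]=⇒lookup; lookup⇒[]=; lookup∘tabulate)
open import Function using (_∘_; id)
open import Function.Definitions using (Injective)
open import Relation.Binary.PropositionalEquality
  using (_≡_; refl; sym; trans; cong; cong₂; subst; subst₂; module ≡-Reasoning)
open import Relation.Nullary using (yes; no; contradiction)
open import Relation.Nullary.Decidable using (⌊_⌋)

-- expTaylor p n j = ∑_{k ≤ n} (n! / k!) · p^(n-k) · j^k, i.e. n! pⁿ times the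
-- degree-n Taylor polynomial of exp at j / p.
expTaylor : ℕ → ℕ → ℕ → ℕ
expTaylor p zero    j = 1
expTaylor p (suc n) j = suc n * p * expTaylor p n j + j ^ suc n

expTaylor-diag : ∀ p n → expTaylor p n p ≡ p ^ n * eNum n
expTaylor-diag p zero    = refl
expTaylor-diag p (suc n) = begin
  suc n * p * expTaylor p n p + p ^ suc n  ≡⟨ cong (λ t → suc n * p * t + p ^ suc n) (expTaylor-diag p n) ⟩
  suc n * p * (p ^ n * eNum n) + p * p ^ n ≡⟨ ring (suc n) p (p ^ n) (eNum n) ⟩
  p * p ^ n * (suc n * eNum n + 1)         ∎
  where
  open ≡-Reasoning
  ring : ∀ k p x e → k * p * (x * e) + p * x ≡ p * x * (k * e + 1)
  ring = solve-∀

expTaylor-zero : ∀ p n → expTaylor p n 0 ≡ n ! * p ^ n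
expTaylor-zero p zero    = refl
expTaylor-zero p (suc n) = begin
  suc n * p * expTaylor p n 0 + 0 ≡⟨ cong (λ t → suc n * p * t + 0) (expTaylor-zero p n) ⟩
  suc n * p * (n ! * p ^ n) + 0   ≡⟨ ring (suc n) p (n !) (p ^ n) ⟩
  suc n * n ! * (p * p ^ n)       ∎
  where
  open ≡-Reasoning
  ring : ∀ k p f x → k * p * (f * x) + 0 ≡ k * f * (p * x)
  ring = solve-∀

[1+j]^[1+n]≤j^[1+n]+[1+n]*[1+j]^n : ∀ j n → suc j ^ suc n ≤ j ^ suc n + suc n * suc j ^ n
[1+j]^[1+n]≤j^[1+n]+[1+n]*[1+j]^n j zero    = ≤-reflexive (ring j)
  where
  ring : ∀ j → suc j * 1 ≡ j * 1 + 1 * 1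
  ring = solve-∀
[1+j]^[1+n]≤j^[1+n]+[1+n]*[1+j]^n j (suc n) = begin
  suc j * suc j ^ suc n
    ≤⟨ *-monoʳ-≤ (suc j) ([1+j]^[1+n]≤j^[1+n]+[1+n]*[1+j]^n j n) ⟩
  suc j * (j ^ suc n + suc n * suc j ^ n)
    ≡⟨ ring j (j ^ suc n) (suc j ^ n) n ⟩
  j * j ^ suc n + (j ^ suc n + suc n * (suc j * suc j ^ n))
    ≤⟨ +-monoʳ-≤ (j * j ^ suc n) (+-monoˡ-≤ _ (^-monoˡ-≤ (suc n) (n≤1+n j))) ⟩
  j * j ^ suc n + suc (suc n) * (suc j * suc j ^ n) ∎
  where
  open ≤-Reasoning
  ring : ∀ j a b n → suc j * (a + suc n * b) ≡ j * a + (a + suc n * (suc j * b))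
  ring = solve-∀

expTaylor-step : ∀ p n j →
  p * expTaylor p n (suc j) + suc j ^ n ≤ p * expTaylor p n j + expTaylor p n (suc j)
expTaylor-step p zero    j = ≤-refl
expTaylor-step p (suc n) j = begin
  p * (k * p * a + U) + U
    ≡⟨ ring₁ p k a U ⟩
  k * p * (p * a) + p * U + U
    ≤⟨ +-monoˡ-≤ U (+-monoʳ-≤ (k * p * (p * a)) (*-monoʳ-≤ p ([1+j]^[1+n]≤j^[1+n]+[1+n]*[1+j]^n j n))) ⟩
  k * p * (p * a) + p * (j ^ k + k * suc j ^ n) + U
    ≡⟨ ring₂ p k a (j ^ k) (suc j ^ n) U ⟩
  k * p * (p * a + suc j ^ n) + p * j ^ k + U
    ≤⟨ +-monoˡ-≤ U (+-monoˡ-≤ _ (*-monoʳ-≤ (k * p) (expTaylor-step p n j))) ⟩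
  k * p * (p * b + a) + p * j ^ k + U
    ≡⟨ ring₃ p k a b (j ^ k) U ⟩
  p * (k * p * b + j ^ k) + (k * p * a + U) ∎
  where
  open ≤-Reasoning
  k = suc n
  a = expTaylor p n (suc j)
  b = expTaylor p n j
  U = suc j ^ suc n
  ring₁ : ∀ p k a U → p * (k * p * a + U) + U ≡ k * p * (p * a) + p * U + U
  ring₁ = solve-∀
  ring₂ : ∀ p k a x y U → k * p * (p * a) + p * (x + k * y) + U ≡ k * p * (p * a + y) + p * x + U
  ring₂ = solve-∀
  ring₃ : ∀ p k a b x U → k * p * (p * b + a) + p * x + U ≡ p * (k * p * b + x) + (k * p * a + U)
  ring₃ = solve-∀

-- The discrete form of exp (1 / p) ≤ p / (p − 1), for p = 1 + q.
expTaylor-ratio : ∀ q n j → q * expTaylor (suc q) n (suc j) ≤ suc q * expTaylor (suc q) n j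
expTaylor-ratio q n j = +-cancelʳ-≤ a (q * a) (suc q * b) (begin
  q * a + a             ≡⟨ +-comm (q * a) a ⟩
  suc q * a             ≤⟨ m≤m+n (suc q * a) _ ⟩
  suc q * a + suc j ^ n ≤⟨ expTaylor-step (suc q) n j ⟩
  suc q * b + a         ∎)
  where
  open ≤-Reasoning
  a = expTaylor (suc q) n (suc j)
  b = expTaylor (suc q) n j

expTaylor-iterate : ∀ q n j → q ^ j * expTaylor (suc q) n j ≤ suc q ^ j * expTaylor (suc q) n 0
expTaylor-iterate q n zero    = ≤-refl
expTaylor-iterate q n (suc j) = begin
  q * q ^ j * expTaylor (suc q) n (suc j)    ≡⟨ ring₁ q (q ^ j) _ ⟩
  q ^ j * (q * expTaylor (suc q) n (suc j))  ≤⟨ *-monoʳ-≤ (q ^ j) (expTaylor-ratio q n j) ⟩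
  q ^ j * (suc q * expTaylor (suc q) n j)    ≡⟨ ring₂ (q ^ j) (suc q) _ ⟩
  suc q * (q ^ j * expTaylor (suc q) n j)    ≤⟨ *-monoʳ-≤ (suc q) (expTaylor-iterate q n j) ⟩
  suc q * (suc q ^ j * expTaylor (suc q) n 0) ≡⟨ sym (*-assoc (suc q) (suc q ^ j) _) ⟩
  suc q * suc q ^ j * expTaylor (suc q) n 0  ∎
  where
  open ≤-Reasoning
  ring₁ : ∀ q x t → q * x * t ≡ x * (q * t)
  ring₁ = solve-∀
  ring₂ : ∀ x p t → x * (p * t) ≡ p * (x * t)
  ring₂ = solve-∀

eNum*q^[1+q]≤n!*[1+q]^[1+q] : ∀ q n → eNum n * q ^ suc q ≤ n ! * suc q ^ suc q
eNum*q^[1+q]≤n!*[1+q]^[1+q] q n = *-cancelʳ-≤ _ _ (p ^ n) {{>-nonZero (m^n>0 p n)}} (begin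
  eNum n * q ^ p * p ^ n       ≡⟨ ring₁ (eNum n) (q ^ p) (p ^ n) ⟩
  q ^ p * (p ^ n * eNum n)     ≡⟨ cong (q ^ p *_) (sym (expTaylor-diag p n)) ⟩
  q ^ p * expTaylor p n p      ≤⟨ expTaylor-iterate q n p ⟩
  p ^ p * expTaylor p n 0      ≡⟨ cong (p ^ p *_) (expTaylor-zero p n) ⟩
  p ^ p * (n ! * p ^ n)        ≡⟨ ring₂ (p ^ p) (n !) (p ^ n) ⟩
  n ! * p ^ p * p ^ n          ∎)
  where
  open ≤-Reasoning
  p = suc q
  ring₁ : ∀ a b c → a * b * c ≡ b * (c * a)
  ring₁ = solve-∀
  ring₂ : ∀ a b c → a * (b * c) ≡ b * a * c
  ring₂ = solve-∀

n!≤eNum : ∀ n → n ! ≤ eNum n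
n!≤eNum zero    = ≤-refl
n!≤eNum (suc n) = ≤-trans (*-monoʳ-≤ (suc n) (n!≤eNum n)) (m≤m+n _ 1)

-- The case q = 5 of the previous bound, since 6⁶ ≤ 3 · 5⁶.
eNum≤3*n! : ∀ n → eNum n ≤ 3 * n !
eNum≤3*n! n = *-cancelˡ-≤ (5 ^ 6) (begin
  5 ^ 6 * eNum n    ≡⟨ *-comm (5 ^ 6) (eNum n) ⟩
  eNum n * 5 ^ 6    ≤⟨ eNum*q^[1+q]≤n!*[1+q]^[1+q] 5 n ⟩
  n ! * 6 ^ 6       ≤⟨ *-monoʳ-≤ (n !) (≤ᵇ⇒≤ (6 ^ 6) (5 ^ 6 * 3) _) ⟩
  n ! * (5 ^ 6 * 3) ≡⟨ ring (n !) ⟩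
  5 ^ 6 * (3 * n !) ∎)
  where
  open ≤-Reasoning
  ring : ∀ x → x * (5 ^ 6 * 3) ≡ 5 ^ 6 * (3 * x)
  ring = solve-∀

-- The state after i greedy steps, for R = rep~(C) with |C| = 1 + q and F = rep~(Aᵢ): every
-- step so far gained at least two voters and R − F ≤ (1 − 1/(1 + q))ⁱ R; or F ≥ R; or some
-- step gained a single voter when F was K + i' with K ≥ i'.
data Progress (R q : ℕ) : ℕ → ℕ → Set where
  geometric : ∀ {i F} → 2 * i ≤ F → suc q ^ i * R ≤ suc q ^ i * F + q ^ i * R → Progress R q i F
  saturated : ∀ {i F} → R ≤ F → Progress R q i F
  stalled   : ∀ {i F} K → R ≤ 2 * K + suc q → K + i ≤ F → Progress R q i F

progress-start : ∀ R q F → Progress R q 0 F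
progress-start R q F = geometric z≤n (m≤n+m (1 * R) (1 * F))

geometric-step : ∀ q i R F F' → suc q ^ i * R ≤ suc q ^ i * F + q ^ i * R →
  R + suc q * F ≤ suc q * F' + F → suc q ^ suc i * R ≤ suc q ^ suc i * F' + q ^ suc i * R
geometric-step q i R F F' shrunk greedy = +-cancelʳ-≤ (P * p * F) _ _ (begin
  p * P * R + P * p * F                        ≡⟨ ring₁ q P R F ⟩
  q * (P * R) + P * (R + p * F)                ≤⟨ +-mono-≤ (*-monoʳ-≤ q shrunk) (*-monoʳ-≤ P greedy) ⟩
  q * (P * F + Q * R) + P * (p * F' + F)       ≡⟨ ring₂ q P Q R F F' ⟩
  p * P * F' + q * Q * R + P * p * F           ∎)
  where
  open ≤-Reasoning
  p = suc q
  P = suc q ^ i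
  Q = q ^ i
  ring₁ : ∀ q P R F → suc q * P * R + P * suc q * F ≡ q * (P * R) + P * (R + suc q * F)
  ring₁ = solve-∀
  ring₂ : ∀ q P Q R F F' →
    q * (P * F + Q * R) + P * (suc q * F' + F) ≡ suc q * P * F' + q * Q * R + P * suc q * F
  ring₂ = solve-∀

unit-gain-bound : ∀ R p F → R + p * F ≤ p * suc F + F → R ≤ F + p
unit-gain-bound R p F greedy = +-cancelʳ-≤ (p * F) R (F + p) (begin
  R + p * F      ≤⟨ greedy ⟩
  p * suc F + F  ≡⟨ ring p F ⟩
  F + p + p * F  ∎)
  where
  open ≤-Reasoning
  ring : ∀ p F → p * suc F + F ≡ F + p + p * F
  ring = solve-∀

stall-start : ∀ {R q i F} → 2 * i ≤ F → R ≤ F + suc q → Progress R q (suc i) (suc F)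
stall-start {R} {q} {i} {F} 2i≤F R≤F+p = stalled K R≤2K+p (≤-reflexive K+[1+i]≡1+F)
  where
  open ≤-Reasoning
  K = F ∸ i
  K+i≡F : K + i ≡ F
  K+i≡F = m∸n+n≡m (≤-trans (m≤m+n i (i + 0)) 2i≤F)
  i≤K : i ≤ K
  i≤K = +-cancelʳ-≤ i i K (begin
    i + i       ≤⟨ +-monoʳ-≤ i (≤-reflexive (sym (+-identityʳ i))) ⟩
    2 * i       ≤⟨ 2i≤F ⟩
    F           ≡⟨ sym K+i≡F ⟩
    K + i       ∎)
  R≤2K+p : R ≤ 2 * K + suc q
  R≤2K+p = begin
    R               ≤⟨ R≤F+p ⟩
    F + suc q       ≡⟨ cong (_+ suc q) (sym K+i≡F) ⟩
    K + i + suc q   ≤⟨ +-monoˡ-≤ (suc q) (+-monoʳ-≤ K (≤-trans i≤K (≤-reflexive (sym (+-identityʳ K))))) ⟩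
    2 * K + suc q   ∎
  K+[1+i]≡1+F : K + suc i ≡ suc F
  K+[1+i]≡1+F = trans (+-suc K i) (cong suc K+i≡F)

progress-step : ∀ {R q i F F'} → Progress R q i F → F ≤ F' →
  R + suc q * F ≤ suc q * F' + F → Progress R q (suc i) F'
progress-step {R} {q} {i} {F} {F'} prog F≤F' greedy with R ≤? F'
... | yes R≤F' = saturated R≤F'
... | no R≰F' = continue prog
  where
  p = suc q
  F<F' : F < F'
  F<F' with F' ≤? F
  ... | no F'≰F = ≰⇒> F'≰F
  ... | yes F'≤F = contradiction (≤-trans R≤F F≤F') R≰F'
    where
    R≤F : R ≤ F
    R≤F = +-cancelʳ-≤ (p * F) R F (begin
      R + p * F   ≤⟨ greedy ⟩
      p * F' + F  ≤⟨ +-monoˡ-≤ F (*-monoʳ-≤ p F'≤F) ⟩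
      p * F + F   ≡⟨ +-comm (p * F) F ⟩
      F + p * F   ∎)
      where open ≤-Reasoning
  continue : Progress R q i F → Progress R q (suc i) F'
  continue (saturated R≤F) = saturated (≤-trans R≤F F≤F')
  continue (stalled K R≤2K+p K+i≤F) =
    stalled K R≤2K+p (≤-trans (≤-reflexive (+-suc K i)) (≤-trans (s≤s K+i≤F) F<F'))
  continue (geometric 2i≤F shrunk) with suc (suc F) ≤? F'
  ... | yes 2+F≤F' = geometric (≤-trans (≤-reflexive (*-suc 2 i)) (≤-trans (+-monoʳ-≤ 2 2i≤F) 2+F≤F'))
                               (geometric-step q i R F F' shrunk greedy)
  ... | no 2+F≰F' = subst (Progress R q (suc i)) (sym F'≡1+F)
    (stall-start 2i≤F (unit-gain-bound R p F (subst (λ x → R + p * F ≤ p * x + F) F'≡1+F greedy)))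
    where
    F'≡1+F : F' ≡ suc F
    F'≡1+F = ≤-antisym (≤-pred (≰⇒> 2+F≰F')) F<F'

geometric-bound : ∀ N D P Q Y Z → 0 < P → (N + D) * Q ≤ N * P →
  P * Y ≤ P * Z + Q * Y → D * Y ≤ (N + D) * Z
geometric-bound N D P Q Y Z P>0 NDQ≤NP shrunk =
  *-cancelʳ-≤ (D * Y) ((N + D) * Z) P {{>-nonZero P>0}} (+-cancelʳ-≤ (N * P * Y) _ _ (begin
    D * Y * P + N * P * Y        ≡⟨ ring₁ N D P Y ⟩
    (N + D) * (P * Y)            ≤⟨ *-monoʳ-≤ (N + D) shrunk ⟩
    (N + D) * (P * Z + Q * Y)    ≡⟨ ring₂ N D P Q Y Z ⟩
    (N + D) * Z * P + (N + D) * Q * Y ≤⟨ +-monoʳ-≤ ((N + D) * Z * P) (*-monoˡ-≤ Y NDQ≤NP) ⟩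
    (N + D) * Z * P + N * P * Y  ∎))
  where
  open ≤-Reasoning
  ring₁ : ∀ N D P Y → D * Y * P + N * P * Y ≡ (N + D) * (P * Y)
  ring₁ = solve-∀
  ring₂ : ∀ N D P Q Y Z → (N + D) * (P * Z + Q * Y) ≡ (N + D) * Z * P + (N + D) * Q * Y
  ring₂ = solve-∀

remove-offset : ∀ N D X E p → D * (X + p) ≤ (N + D) * (E + p) → p ≤ E → D * X ≤ (N + D + N) * E
remove-offset N D X E p bound p≤E = +-cancelʳ-≤ (D * p) _ _ (begin
  D * X + D * p               ≡⟨ *-distribˡ-+ D X p ⟨
  D * (X + p)                 ≤⟨ bound ⟩
  (N + D) * (E + p)           ≡⟨ ring₁ N D E p ⟩
  (N + D) * E + N * p + D * p ≤⟨ +-monoˡ-≤ (D * p) (+-monoʳ-≤ ((N + D) * E) (*-monoʳ-≤ N p≤E)) ⟩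
  (N + D) * E + N * E + D * p ≡⟨ ring₂ N D E p ⟩
  (N + D + N) * E + D * p     ∎)
  where
  open ≤-Reasoning
  ring₁ : ∀ N D E p → (N + D) * (E + p) ≡ (N + D) * E + N * p + D * p
  ring₁ = solve-∀
  ring₂ : ∀ N D E p → (N + D) * E + N * E + D * p ≡ (N + D + N) * E + D * p
  ring₂ = solve-∀

progress-final : ∀ {q M N X E} → N ≤ M → M * q ^ suc q ≤ N * suc q ^ suc q → M ≤ 3 * N →
  Progress (X + suc q) q (suc q) (E + suc q) → (M ∸ N) * X ≤ (M + N) * E
progress-final {q} {M} {N} {X} {E} N≤M Mq^p≤Np^p M≤3N progress =
  subst (λ M → D * X ≤ (M + N) * E) N+D≡M (final progress)
  where
  open ≤-Reasoning
  p = suc q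
  D = M ∸ N
  N+D≡M : N + D ≡ M
  N+D≡M = m+[n∸m]≡n N≤M
  D≤2N : D ≤ N + N
  D≤2N = +-cancelˡ-≤ N D (N + N) (≤-trans (≤-reflexive N+D≡M) (≤-trans M≤3N (≤-reflexive (ring N))))
    where
    ring : ∀ N → 3 * N ≡ N + (N + N)
    ring = solve-∀
  final : Progress (X + p) q p (E + p) → D * X ≤ (N + D + N) * E
  final (saturated X+p≤E+p) =
    *-mono-≤ (≤-trans (m≤n+m D N) (m≤m+n (N + D) N)) (+-cancelʳ-≤ p X E X+p≤E+p)
  final (stalled K X+p≤2K+p K+p≤E+p) = begin
    D * X           ≤⟨ *-monoʳ-≤ D (≤-trans (+-cancelʳ-≤ p X (2 * K) X+p≤2K+p)
                                            (*-monoʳ-≤ 2 (+-cancelʳ-≤ p K E K+p≤E+p))) ⟩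
    D * (2 * E)     ≡⟨ ring₁ D E ⟩
    (D + D) * E     ≤⟨ *-monoˡ-≤ E (≤-trans (+-monoˡ-≤ D D≤2N) (≤-reflexive (ring₂ N D))) ⟩
    (N + D + N) * E ∎
    where
    ring₁ : ∀ D E → D * (2 * E) ≡ (D + D) * E
    ring₁ = solve-∀
    ring₂ : ∀ N D → N + N + D ≡ N + D + N
    ring₂ = solve-∀
  final (geometric 2p≤E+p shrunk) =
    remove-offset N D X E p
      (geometric-bound N D (p ^ p) (q ^ p) (X + p) (E + p) (m^n>0 p p)
        (subst (λ M → M * q ^ p ≤ N * p ^ p) (sym N+D≡M) Mq^p≤Np^p) shrunk)
      (+-cancelʳ-≤ p p E (≤-trans (≤-reflexive (ring p)) 2p≤E+p))
    where
    ring : ∀ p → p + p ≡ 2 * p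
    ring = solve-∀

fromBool : Bool → ℕ
fromBool true  = 1
fromBool false = 0

𝟙 : ∀ {n} → Subset n → Fin n → ℕ
𝟙 p i = fromBool (lookup p i)

∣p∣≡∑𝟙 : ∀ {n} (p : Subset n) → ∣ p ∣ ≡ ∑[ i < n ] 𝟙 p i
∣p∣≡∑𝟙 []            = refl
∣p∣≡∑𝟙 (inside ∷ p)  = cong suc (∣p∣≡∑𝟙 p)
∣p∣≡∑𝟙 (outside ∷ p) = ∣p∣≡∑𝟙 p

∈⇒𝟙≡1 : ∀ {n} {p : Subset n} {x} → x ∈ p → 𝟙 p x ≡ 1
∈⇒𝟙≡1 x∈p rewrite []=⇒lookup x∈p = refl

∉⇒𝟙≡0 : ∀ {n} {p : Subset n} {x} → x ∉ p → 𝟙 p x ≡ 0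
∉⇒𝟙≡0 {p = p} {x} x∉p with lookup p x in eq
... | true  = contradiction (lookup⇒[]= x p eq) x∉p
... | false = refl

𝟙≤1 : ∀ {n} (p : Subset n) x → 𝟙 p x ≤ 1
𝟙≤1 p x with lookup p x
... | true  = ≤-refl
... | false = z≤n

∑-mono-≤ : ∀ {n} {f g : Fin n → ℕ} → (∀ i → f i ≤ g i) → sum f ≤ sum g
∑-mono-≤ {zero}  f≤g = z≤n
∑-mono-≤ {suc n} f≤g = +-mono-≤ (f≤g zero) (∑-mono-≤ (λ i → f≤g (suc i)))

f≤∑f : ∀ {n} (f : Fin n → ℕ) i → f i ≤ sum f
f≤∑f {suc n} f i = ≤-trans (m≤m+n (f i) _) (≤-reflexive (sym (sum-remove {i = i} f)))

∑-∸ : ∀ {n} {f g : Fin n → ℕ} → (∀ i → g i ≤ f i) → ∑[ i < n ] (f i ∸ g i) ≡ sum f ∸ sum g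
∑-∸ {n} {f} {g} g≤f = begin
  ∑[ i < n ] (f i ∸ g i)                       ≡⟨ m+n∸n≡m _ (sum g) ⟨
  ∑[ i < n ] (f i ∸ g i) + sum g ∸ sum g       ≡⟨ cong (_∸ sum g) (∑-distrib-+ (λ i → f i ∸ g i) g) ⟨
  ∑[ i < n ] (f i ∸ g i + g i) ∸ sum g         ≡⟨ cong (_∸ sum g) (sum-cong-≗ (λ i → m∸n+n≡m (g≤f i))) ⟩
  sum f ∸ sum g                                ∎
  where open ≡-Reasoning

∣p∩∁q∣+∣q∣≡∣p∪q∣ : ∀ {n} (p q : Subset n) → ∣ p ∩ ∁ q ∣ + ∣ q ∣ ≡ ∣ p ∪ q ∣
∣p∩∁q∣+∣q∣≡∣p∪q∣ []            []            = refl
∣p∩∁q∣+∣q∣≡∣p∪q∣ (inside ∷ p)  (inside ∷ q)  = trans (+-suc _ _) (cong suc (∣p∩∁q∣+∣q∣≡∣p∪q∣ p q))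
∣p∩∁q∣+∣q∣≡∣p∪q∣ (outside ∷ p) (inside ∷ q)  = trans (+-suc _ _) (cong suc (∣p∩∁q∣+∣q∣≡∣p∪q∣ p q))
∣p∩∁q∣+∣q∣≡∣p∪q∣ (inside ∷ p)  (outside ∷ q) = cong suc (∣p∩∁q∣+∣q∣≡∣p∪q∣ p q)
∣p∩∁q∣+∣q∣≡∣p∪q∣ (outside ∷ p) (outside ∷ q) = ∣p∩∁q∣+∣q∣≡∣p∪q∣ p q

x∉p⇒∣p∪⁅x⁆∣≡1+∣p∣ : ∀ {n} {p : Subset n} {x} → x ∉ p → ∣ p ∪ ⁅ x ⁆ ∣ ≡ suc ∣ p ∣
x∉p⇒∣p∪⁅x⁆∣≡1+∣p∣ {p = inside  ∷ p} {zero}  x∉p = contradiction here x∉p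
x∉p⇒∣p∪⁅x⁆∣≡1+∣p∣ {p = outside ∷ p} {zero}  x∉p = cong (suc ∘ ∣_∣) (∪-identityʳ p)
x∉p⇒∣p∪⁅x⁆∣≡1+∣p∣ {p = inside  ∷ p} {suc x} x∉p = cong suc (x∉p⇒∣p∪⁅x⁆∣≡1+∣p∣ (x∉p ∘ there))
x∉p⇒∣p∪⁅x⁆∣≡1+∣p∣ {p = outside ∷ p} {suc x} x∉p = x∉p⇒∣p∪⁅x⁆∣≡1+∣p∣ (x∉p ∘ there)

x∈p⇒⁅x⁆⊆p : ∀ {n} {p : Subset n} {x} → x ∈ p → ⁅ x ⁆ ⊆ p
x∈p⇒⁅x⁆⊆p {p = p} {x} x∈p y∈⁅x⁆ = subst (_∈ p) (sym (x∈⁅y⁆⇒x≡y x y∈⁅x⁆)) x∈p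

x∈p⇒p∪⁅x⁆≡p : ∀ {n} {p : Subset n} {x} → x ∈ p → p ∪ ⁅ x ⁆ ≡ p
x∈p⇒p∪⁅x⁆≡p {p = p} {x} x∈p =
  ⊆-antisym (λ y∈ → [ id , x∈p⇒⁅x⁆⊆p x∈p ] (x∈p∪q⁻ p ⁅ x ⁆ y∈)) (p⊆p∪q ⁅ x ⁆)

∣p∣≡0⇒p≡⊥ : ∀ {n} {p : Subset n} → ∣ p ∣ ≡ 0 → p ≡ ⊥
∣p∣≡0⇒p≡⊥ {p = p} ∣p∣≡0 = Empty-unique λ { (x , x∈p) → 1+n≰n (begin
  1           ≡⟨ ∣⁅x⁆∣≡1 x ⟨
  ∣ ⁅ x ⁆ ∣   ≤⟨ p⊆q⇒∣p∣≤∣q∣ (x∈p⇒⁅x⁆⊆p x∈p) ⟩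
  ∣ p ∣       ≡⟨ ∣p∣≡0 ⟩
  0           ∎) }
  where open ≤-Reasoning

anyF⁺ : ∀ {n} (f : Fin n → Bool) c → f c ≡ true → anyF f ≡ true
anyF⁺ f zero    fc≡true rewrite fc≡true = refl
anyF⁺ f (suc c) fc≡true rewrite anyF⁺ (f ∘ suc) c fc≡true = ∨-zeroʳ (f zero)

anyF⁻ : ∀ {n} (f : Fin n → Bool) → anyF f ≡ true → ∃ λ c → f c ≡ true
anyF⁻ {suc n} f any with f zero in f0≡true
... | true  = zero , f0≡true
... | false with anyF⁻ (f ∘ suc) any
...   | c , fc≡true = suc c , fc≡true

anyF-cong : ∀ {n} {f g : Fin n → Bool} → (∀ i → f i ≡ g i) → anyF f ≡ anyF g
anyF-cong {zero}  f≗g = refl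
anyF-cong {suc n} f≗g = cong₂ _∨_ (f≗g zero) (anyF-cong (f≗g ∘ suc))

anyF-∨ : ∀ {n} (f g : Fin n → Bool) → anyF (λ i → f i ∨ g i) ≡ anyF f ∨ anyF g
anyF-∨ {zero}  f g = refl
anyF-∨ {suc n} f g with f zero | g zero
... | true  | _     = refl
... | false | true  = sym (∨-zeroʳ (anyF (f ∘ suc)))
... | false | false = anyF-∨ (f ∘ suc) (g ∘ suc)

fromBool-anyF : ∀ {n} (f : Fin n → Bool) → (∀ i j → f i ≡ true → f j ≡ true → i ≡ j) →
  fromBool (anyF f) ≡ ∑[ i < n ] fromBool (f i)
fromBool-anyF {zero}  f unique = refl
fromBool-anyF {suc n} f unique with f zero in f0≡true
... | true  = cong suc (sym (trans (sum-cong-≗ (cong fromBool ∘ f[1+i]≡false)) (sum-replicate-zero n)))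
  where
  f[1+i]≡false : ∀ i → f (suc i) ≡ false
  f[1+i]≡false i with f (suc i) in f[1+i]≡true
  ... | true  = contradiction (unique zero (suc i) f0≡true f[1+i]≡true) λ ()
  ... | false = refl
... | false = fromBool-anyF (f ∘ suc) (λ i j fi fj → Fin.suc-injective (unique (suc i) (suc j) fi fj))

𝟙-mono-⊆ : ∀ {n} {p q : Subset n} → p ⊆ q → ∀ x → 𝟙 p x ≤ 𝟙 q x
𝟙-mono-⊆ {p = p} p⊆q x with x ∈? p
... | yes x∈p = ≤-reflexive (trans (∈⇒𝟙≡1 x∈p) (sym (∈⇒𝟙≡1 (p⊆q x∈p))))
... | no  x∉p = ≤-trans (≤-reflexive (∉⇒𝟙≡0 x∉p)) z≤n

-- approverSet and memberSet of Defs are definitionally instances of covered.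
covered : ∀ {m n} → (Fin m → Fin n → Bool) → Subset n → Subset m
covered rel X = tabulate (λ v → anyF (λ c → lookup X c ∧ rel v c))

covered-∪ : ∀ {m n} (r s : Fin m → Fin n → Bool) X →
  covered r X ∪ covered s X ≡ covered (λ v c → r v c ∨ s v c) X
covered-∪ {zero}  r s X = refl
covered-∪ {suc m} r s X = cong₂ _∷_ (begin
  anyF (λ c → lookup X c ∧ r zero c) ∨ anyF (λ c → lookup X c ∧ s zero c)
    ≡⟨ anyF-∨ (λ c → lookup X c ∧ r zero c) (λ c → lookup X c ∧ s zero c) ⟨
  anyF (λ c → lookup X c ∧ r zero c ∨ lookup X c ∧ s zero c)
    ≡⟨ anyF-cong (λ c → ∧-distribˡ-∨ (lookup X c) (r zero c) (s zero c)) ⟨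
  anyF (λ c → lookup X c ∧ (r zero c ∨ s zero c)) ∎)
  (covered-∪ (r ∘ suc) (s ∘ suc) X)
  where open ≡-Reasoning

module _ {m n} (rel : Fin m → Fin n → Bool) where

  ∈covered⁺ : ∀ {X c v} → c ∈ X → rel v c ≡ true → v ∈ covered rel X
  ∈covered⁺ {X} {c} {v} c∈X rel≡true = lookup⇒[]= v (covered rel X)
    (trans (lookup∘tabulate _ v) (anyF⁺ _ c (cong₂ _∧_ ([]=⇒lookup c∈X) rel≡true)))

  ∈covered⁻ : ∀ {X v} → v ∈ covered rel X → ∃ λ c → c ∈ X × rel v c ≡ true
  ∈covered⁻ {X} {v} v∈ with anyF⁻ _ (trans (sym (lookup∘tabulate _ v)) ([]=⇒lookup v∈))
  ... | c , X∧rel≡true with lookup X c in c∈X | rel v c in rel≡true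
  ...   | true | true = c , lookup⇒[]= c X c∈X , rel≡true

  covered-mono-⊆ : ∀ {X Y} → X ⊆ Y → covered rel X ⊆ covered rel Y
  covered-mono-⊆ X⊆Y v∈ with ∈covered⁻ v∈
  ... | c , c∈X , rel≡true = ∈covered⁺ (X⊆Y c∈X) rel≡true

  gain : Subset n → Fin n → ℕ
  gain A c = ∣ covered rel (A ∪ ⁅ c ⁆) ∣ ∸ ∣ covered rel A ∣

  newlyCovered : Subset n → Fin n → Fin m → ℕ
  newlyCovered A c v = 𝟙 (covered rel (A ∪ ⁅ c ⁆)) v ∸ 𝟙 (covered rel A) v

  gain≡∑ : ∀ A c → gain A c ≡ ∑[ v < m ] newlyCovered A c v
  gain≡∑ A c = begin
    ∣ covered rel (A ∪ ⁅ c ⁆) ∣ ∸ ∣ covered rel A ∣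
      ≡⟨ cong₂ _∸_ (∣p∣≡∑𝟙 (covered rel (A ∪ ⁅ c ⁆))) (∣p∣≡∑𝟙 (covered rel A)) ⟩
    sum (𝟙 (covered rel (A ∪ ⁅ c ⁆))) ∸ sum (𝟙 (covered rel A))
      ≡⟨ ∑-∸ {f = 𝟙 (covered rel (A ∪ ⁅ c ⁆))} {g = 𝟙 (covered rel A)}
             (𝟙-mono-⊆ (covered-mono-⊆ {A} {A ∪ ⁅ c ⁆} (p⊆p∪q ⁅ c ⁆))) ⟨
    ∑[ v < m ] newlyCovered A c v ∎
    where open ≡-Reasoning

  𝟙-covered-≤ : ∀ A C v → 𝟙 (covered rel C) v ≤ 𝟙 (covered rel A) v + ∑[ c < n ] (𝟙 C c * newlyCovered A c v)
  𝟙-covered-≤ A C v with v ∈? covered rel A | v ∈? covered rel C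
  ... | yes v∈A | _       =
    ≤-trans (𝟙≤1 (covered rel C) v) (≤-trans (≤-reflexive (sym (∈⇒𝟙≡1 v∈A))) (m≤m+n _ _))
  ... | no  _   | no v∉C  = ≤-trans (≤-reflexive (∉⇒𝟙≡0 v∉C)) z≤n
  ... | no  v∉A | yes v∈C with ∈covered⁻ {C} v∈C
  ...   | c , c∈C , rel≡true = begin
    𝟙 (covered rel C) v
      ≡⟨ ∈⇒𝟙≡1 v∈C ⟩
    1
      ≡⟨ cong₂ _*_ (∈⇒𝟙≡1 {p = C} c∈C) (cong₂ _∸_ (∈⇒𝟙≡1 v∈A∪⁅c⁆) (∉⇒𝟙≡0 v∉A)) ⟨
    𝟙 C c * newlyCovered A c v
      ≤⟨ f≤∑f (λ c → 𝟙 C c * newlyCovered A c v) c ⟩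
    ∑[ c < n ] (𝟙 C c * newlyCovered A c v)
      ≤⟨ m≤n+m _ _ ⟩
    𝟙 (covered rel A) v + ∑[ c < n ] (𝟙 C c * newlyCovered A c v) ∎
    where
    open ≤-Reasoning
    v∈A∪⁅c⁆ : v ∈ covered rel (A ∪ ⁅ c ⁆)
    v∈A∪⁅c⁆ = ∈covered⁺ {A ∪ ⁅ c ⁆} (x∈p∪q⁺ (inj₂ (x∈⁅x⁆ c))) rel≡true

  ∣covered∣-≤ : ∀ A C g → (∀ c → gain A c ≤ g) → ∣ covered rel C ∣ ≤ ∣ covered rel A ∣ + ∣ C ∣ * g
  ∣covered∣-≤ A C g gain≤g = begin
    ∣ covered rel C ∣
      ≡⟨ ∣p∣≡∑𝟙 (covered rel C) ⟩
    ∑[ v < m ] 𝟙 (covered rel C) v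
      ≤⟨ ∑-mono-≤ (𝟙-covered-≤ A C) ⟩
    ∑[ v < m ] (𝟙 (covered rel A) v + ∑[ c < n ] (𝟙 C c * newlyCovered A c v))
      ≡⟨ ∑-distrib-+ (𝟙 (covered rel A)) (λ v → ∑[ c < n ] (𝟙 C c * newlyCovered A c v)) ⟩
    ∑[ v < m ] 𝟙 (covered rel A) v + ∑[ v < m ] ∑[ c < n ] (𝟙 C c * newlyCovered A c v)
      ≡⟨ cong₂ _+_ (∣p∣≡∑𝟙 (covered rel A)) (∑-comm (λ c v → 𝟙 C c * newlyCovered A c v)) ⟨
    ∣ covered rel A ∣ + ∑[ c < n ] ∑[ v < m ] (𝟙 C c * newlyCovered A c v)
      ≡⟨ cong (∣ covered rel A ∣ +_) (sum-cong-≗ λ c →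
           trans (cong (𝟙 C c *_) (gain≡∑ A c)) (*-distribˡ-sum (𝟙 C c) (newlyCovered A c))) ⟨
    ∣ covered rel A ∣ + ∑[ c < n ] (𝟙 C c * gain A c)
      ≤⟨ +-monoʳ-≤ ∣ covered rel A ∣ (∑-mono-≤ λ c → *-monoʳ-≤ (𝟙 C c) (gain≤g c)) ⟩
    ∣ covered rel A ∣ + ∑[ c < n ] (𝟙 C c * g)
      ≡⟨ cong (∣ covered rel A ∣ +_) (trans (cong (_* g) (∣p∣≡∑𝟙 C)) (*-distribʳ-sum g (𝟙 C))) ⟨
    ∣ covered rel A ∣ + ∣ C ∣ * g ∎
    where open ≤-Reasoning

fromBool-∧ : ∀ x y → fromBool (x ∧ y) ≡ fromBool x * fromBool y
fromBool-∧ true  y = sym (+-identityʳ (fromBool y))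
fromBool-∧ false y = refl

fromBool-⌊≟⌋ : ∀ {n} (a v : Fin n) → fromBool ⌊ a ≟ v ⌋ ≡ 𝟙 ⁅ a ⁆ v
fromBool-⌊≟⌋ a v with a ≟ v
... | yes refl = sym (∈⇒𝟙≡1 (x∈⁅x⁆ a))
... | no  a≢v  = sym (∉⇒𝟙≡0 (x≢y⇒x∉⁅y⁆ (a≢v ∘ sym)))

∣covered-graph∣≡∣p∣ : ∀ {m n} (f : Fin n → Fin m) → Injective _≡_ _≡_ f →
  ∀ X → ∣ covered (λ v c → ⌊ f c ≟ v ⌋) X ∣ ≡ ∣ X ∣
∣covered-graph∣≡∣p∣ {m} {n} f f-injective X = begin
  ∣ covered (λ v c → ⌊ f c ≟ v ⌋) X ∣
    ≡⟨ ∣p∣≡∑𝟙 (covered (λ v c → ⌊ f c ≟ v ⌋) X) ⟩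
  ∑[ v < m ] 𝟙 (covered (λ v c → ⌊ f c ≟ v ⌋) X) v
    ≡⟨ sum-cong-≗ (λ v → cong fromBool (lookup∘tabulate (λ v → anyF (λ c → lookup X c ∧ ⌊ f c ≟ v ⌋)) v)) ⟩
  ∑[ v < m ] fromBool (anyF (λ c → lookup X c ∧ ⌊ f c ≟ v ⌋))
    ≡⟨ sum-cong-≗ (λ v → fromBool-anyF (λ c → lookup X c ∧ ⌊ f c ≟ v ⌋) (at-most-one v)) ⟩
  ∑[ v < m ] ∑[ c < n ] fromBool (lookup X c ∧ ⌊ f c ≟ v ⌋)
    ≡⟨ sum-cong-≗ (λ v → sum-cong-≗ λ c →
         trans (fromBool-∧ (lookup X c) _) (cong (𝟙 X c *_) (fromBool-⌊≟⌋ (f c) v))) ⟩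
  ∑[ v < m ] ∑[ c < n ] (𝟙 X c * 𝟙 ⁅ f c ⁆ v)
    ≡⟨ ∑-comm (λ v c → 𝟙 X c * 𝟙 ⁅ f c ⁆ v) ⟩
  ∑[ c < n ] ∑[ v < m ] (𝟙 X c * 𝟙 ⁅ f c ⁆ v)
    ≡⟨ sum-cong-≗ (λ c → *-distribˡ-sum (𝟙 X c) (𝟙 ⁅ f c ⁆)) ⟨
  ∑[ c < n ] (𝟙 X c * sum (𝟙 ⁅ f c ⁆))
    ≡⟨ sum-cong-≗ (λ c → cong (𝟙 X c *_) (trans (sym (∣p∣≡∑𝟙 ⁅ f c ⁆)) (∣⁅x⁆∣≡1 (f c)))) ⟩
  ∑[ c < n ] (𝟙 X c * 1)
    ≡⟨ sum-cong-≗ (λ c → *-identityʳ (𝟙 X c)) ⟩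
  ∑[ c < n ] 𝟙 X c
    ≡⟨ ∣p∣≡∑𝟙 X ⟨
  ∣ X ∣ ∎
  where
  open ≡-Reasoning
  graph⇒≡ : ∀ c v → lookup X c ∧ ⌊ f c ≟ v ⌋ ≡ true → f c ≡ v
  graph⇒≡ c v _ with lookup X c | f c ≟ v
  graph⇒≡ c v _ | true | yes fc≡v = fc≡v
  at-most-one : ∀ v i j → lookup X i ∧ ⌊ f i ≟ v ⌋ ≡ true → lookup X j ∧ ⌊ f j ≟ v ⌋ ≡ true → i ≡ j
  at-most-one v i j i↦v j↦v = f-injective (trans (graph⇒≡ i v i↦v) (sym (graph⇒≡ j v j↦v)))

module _ (E : Election) where
  open Election E

  approvesOrIs : Fin nv → Fin nc → Bool
  approvesOrIs v c = approves v c ∨ ⌊ asVoter c ≟ v ⌋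

  repT≡∣covered∣ : ∀ X → repT E X ≡ ∣ covered approvesOrIs X ∣
  repT≡∣covered∣ X = cong ∣_∣ (covered-∪ approves (λ v c → ⌊ asVoter c ≟ v ⌋) X)

  ext+∣p∣≡repT : ∀ X → ext E X + ∣ X ∣ ≡ repT E X
  ext+∣p∣≡repT X = begin
    ext E X + ∣ X ∣              ≡⟨ cong (ext E X +_) (∣covered-graph∣≡∣p∣ asVoter asVoter-injective X) ⟨
    ext E X + ∣ memberSet E X ∣  ≡⟨ ∣p∩∁q∣+∣q∣≡∣p∪q∣ (approverSet E X) (memberSet E X) ⟩
    repT E X                     ∎
    where open ≡-Reasoning

  repT-mono-∪ : ∀ A c → repT E A ≤ repT E (A ∪ ⁅ c ⁆)
  repT-mono-∪ A c rewrite repT≡∣covered∣ A | repT≡∣covered∣ (A ∪ ⁅ c ⁆) =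
    p⊆q⇒∣p∣≤∣q∣ (covered-mono-⊆ approvesOrIs {A} {A ∪ ⁅ c ⁆} (p⊆p∪q ⁅ c ⁆))

  gain≤greedy-gain : ∀ A c → (∀ c' → c' ∉ A → repT E (A ∪ ⁅ c' ⁆) ≤ repT E (A ∪ ⁅ c ⁆)) →
    ∀ c' → gain approvesOrIs A c' ≤ repT E (A ∪ ⁅ c ⁆) ∸ repT E A
  gain≤greedy-gain A c greedy c' with c' ∈? A
  ... | yes c'∈A rewrite x∈p⇒p∪⁅x⁆≡p c'∈A | n∸n≡0 ∣ covered approvesOrIs A ∣ = z≤n
  ... | no c'∉A rewrite sym (repT≡∣covered∣ A) | sym (repT≡∣covered∣ (A ∪ ⁅ c' ⁆)) =
    ∸-monoˡ-≤ (repT E A) (greedy c' c'∉A)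

  greedy-inequality : ∀ C A c → (∀ c' → c' ∉ A → repT E (A ∪ ⁅ c' ⁆) ≤ repT E (A ∪ ⁅ c ⁆)) →
    repT E C + ∣ C ∣ * repT E A ≤ ∣ C ∣ * repT E (A ∪ ⁅ c ⁆) + repT E A
  greedy-inequality C A c greedy = begin
    R + p * F                ≤⟨ +-monoˡ-≤ (p * F) R≤F+p*g ⟩
    F + p * g + p * F        ≡⟨ ring F g p ⟩
    p * (g + F) + F          ≡⟨ cong (λ x → p * x + F) (m∸n+n≡m (repT-mono-∪ A c)) ⟩
    p * F' + F               ∎
    where
    open ≤-Reasoning
    R = repT E C
    F = repT E A
    F' = repT E (A ∪ ⁅ c ⁆)
    p = ∣ C ∣
    g = F' ∸ F
    ring : ∀ F g p → F + p * g + p * F ≡ p * (g + F) + F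
    ring = solve-∀
    R≤F+p*g : R ≤ F + p * g
    R≤F+p*g = begin
      R                                     ≡⟨ repT≡∣covered∣ C ⟩
      ∣ covered approvesOrIs C ∣            ≤⟨ ∣covered∣-≤ approvesOrIs A C g (gain≤greedy-gain A c greedy) ⟩
      ∣ covered approvesOrIs A ∣ + p * g    ≡⟨ cong (_+ p * g) (repT≡∣covered∣ A) ⟨
      F + p * g                             ∎

  greedy-card : ∀ {i A} → GreedyRun E i A → ∣ A ∣ ≡ i
  greedy-card start              = ∣⊥∣≡0 nc
  greedy-card (step c run c∉A _) = trans (x∉p⇒∣p∪⁅x⁆∣≡1+∣p∣ c∉A) (cong suc (greedy-card run))

  greedy-progress : ∀ {q} C → ∣ C ∣ ≡ suc q → ∀ {i A} → GreedyRun E i A → Progress (repT E C) q i (repT E A)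
  greedy-progress C ∣C∣≡p start = progress-start (repT E C) _ (repT E ⊥)
  greedy-progress C ∣C∣≡p (step {A = A} c run _ greedy) =
    progress-step (greedy-progress C ∣C∣≡p run) (repT-mono-∪ A c)
      (subst (λ p → repT E C + p * repT E A ≤ p * repT E (A ∪ ⁅ c ⁆) + repT E A) ∣C∣≡p
        (greedy-inequality C A c greedy))

theorem4 : (E : Election) → ApprovesOther E →
    (p : ℕ) (A : Subset (Election.nc E)) → GreedyRun E p A →
    (C : Subset (Election.nc E)) → ∣ C ∣ ≡ p →
    (n : ℕ) → (eNum n ∸ n !) * ext E C ≤ (eNum n + n !) * ext E A
theorem4 E _ zero    A start C ∣C∣≡0 n with ∣p∣≡0⇒p≡⊥ {p = C} ∣C∣≡0
... | refl = *-monoˡ-≤ _ (≤-trans (m∸n≤m (eNum n) (n !)) (m≤m+n (eNum n) (n !)))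
theorem4 E _ (suc q) A run   C ∣C∣≡p n =
  progress-final (n!≤eNum n) (eNum*q^[1+q]≤n!*[1+q]^[1+q] q n) (eNum≤3*n! n)
    (subst₂ (λ R F → Progress R q (suc q) F) (offset C ∣C∣≡p) (offset A (greedy-card E run))
      (greedy-progress E C ∣C∣≡p run))
  where
  offset : ∀ X → ∣ X ∣ ≡ suc q → repT E X ≡ ext E X + suc q
  offset X ∣X∣≡p = trans (sym (ext+∣p∣≡repT E X)) (cong (ext E X +_) ∣X∣≡p)
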